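{- Let $\mathbf T$ be an infinite countable homogeneous tournament with its fixed expansion $\mathbf T^*$ (described in the context). If $\mathrm{Age}(\mathbf T^*)$ has the expansion property relative to $\mathrm{Age}(\mathbf T)$, then $\mathrm{Age}(\mathbf T[I_\omega]^*)$ has the expansion property relative to $\mathrm{Age}(\mathbf T[I_\omega])$.
   Context: The infinite countable homogeneous tournaments are $\mathbb Q$ (with $E(x,y)$ iff $x<y$), the dense local order $\mathbf S(2)$ (a countable dense subset $D$ of the unit circle with no antipodal points and not containing the points at angles $\pi/2,3\pi/2$, with $E(x,y)$ iff the counterclockwise angle from $x$ to $y$ is in $(0,\pi)$), and the generic tournament $T^\omega$. Fixed expansions $\mathbf T^*$ containing $E$ and a binary $<$ interpreted as a linear order $<^*$: $\mathbb Q^*$ adds the usual order; $\mathbf S(2)^*$ adds two unary predicates for the two halves of $D$ cut by the line through angles $\pi/2,3\pi/2$ and the order $x<y$ iff ($x,y$ in the same half and $E(x,y)$) or (different halves and $E(y,x)$); $T^{\omega*}$ is the Fraïssé limit of all finite linearly ordered tournaments. $\mathbf T[I_\omega]$ is the directed graph on $T\times\mathbb N$ with $E((x,i),(y,j))$ iff $E^{\mathbf T}(x,y)$. $\mathbf T[I_\omega]^*$ expands it by: for each relation $R$ of $\mathbf T^*$ other than $E,<$, $R((x_1,i_1),\dots,(x_m,i_m))$ iff $R^{\mathbf T^*}(x_1,\dots,x_m)$; $(x,i)<(y,j)$ iff $x<^*y$ or ($x=y$ and $i\prec j$), where $(\mathbb N,\prec)\cong\mathbb Q$. If $\mathcal K^*$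 is a class of expansions of members of $\mathcal K$, it has the expansion property relative to $\mathcal K$ if for every $\mathbf A\in\mathcal K$ there is $\mathbf B\in\mathcal K$ such that every expansion of $\mathbf A$ in $\mathcal K^*$ embeds in every expansion of $\mathbf B$ in $\mathcal K^*$. The age of a structure is the class of finite structures embeddable in it. -}

module Defs where

open import Level using (0ℓ)
open import Data.Nat using (ℕ; _%_)
open import Data.Fin using (Fin; zero; suc)
open import Data.Rational as ℚ using (ℚ)
open import Data.Product using (Σ; _×_; _,_)
open import Data.Sum using (_⊎_)
open import Relation.Nullary using (¬_)
open import Relation.Binary.PropositionalEquality using (_≡_)
open import Function.Bundles using (_⇔_)
open import Function.Definitions using (Injective; Surjective)

-- Structures.  A directed graph (signature {E}), and an "expanded"
-- structure in the signature {E, <, P_0, ..., P_{k-1}} (k unary predicates).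

record Graph : Set₁ where
  field
    V : Set
    E : V → V → Set

record Exp (k : ℕ) : Set₁ where
  field
    V : Set
    E : V → V → Set
    L : V → V → Set
    P : Fin k → V → Set

reduct : ∀ {k} → Exp k → Graph
reduct S = record { V = Exp.V S ; E = Exp.E S }

FRel : ℕ → Set₁
FRel n = Fin n → Fin n → Set

record Expn (k n : ℕ) : Set₁ where
  field
    L : FRel n
    P : Fin k → Fin n → Set

expand : ∀ {k n} → FRel n → Expn k n → Exp k
expand {n = n} A a = record { V = Fin n ; E = A ; L = Expn.L a ; P = Expn.P a }

asGraph : ∀ {n} → FRel n → Graph
asGraph {n} A = record { V = Fin n ; E = A }

IsEmbG : (A B : Graph) → (Graph.V A → Graph.V B) → Set
IsEmbG A B f = Injective _≡_ _≡_ f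
  × (∀ x y → Graph.E A x y ⇔ Graph.E B (f x) (f y))

IsEmb : ∀ {k} (A B : Exp k) → (Exp.V A → Exp.V B) → Set
IsEmb A B f = Injective _≡_ _≡_ f
  × (∀ x y → Exp.E A x y ⇔ Exp.E B (f x) (f y))
  × (∀ x y → Exp.L A x y ⇔ Exp.L B (f x) (f y))
  × (∀ c x → Exp.P A c x ⇔ Exp.P B c (f x))

EmbedsG : Graph → Graph → Set
EmbedsG A B = Σ (Graph.V A → Graph.V B) (IsEmbG A B)

Embeds : ∀ {k} → Exp k → Exp k → Set
Embeds A B = Σ (Exp.V A → Exp.V B) (IsEmb A B)

InAgeG : (T : Graph) → ∀ {n} → FRel n → Set
InAgeG T A = EmbedsG (asGraph A) T

InAge : ∀ {k} (S : Exp k) → ∀ {n} → FRel n → Expn k n → Set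
InAge S A a = Embeds (expand A a) S

ExpansionProperty : ∀ {k} → Exp k → Set₁
ExpansionProperty {k} S =
  ∀ (n : ℕ) (A : FRel n) → InAgeG (reduct S) A →
  Σ ℕ λ m → Σ (FRel m) λ B → InAgeG (reduct S) B ×
    (∀ (a : Expn k n) (b : Expn k m) →
       InAge S A a → InAge S B b → Embeds (expand A a) (expand B b))

-- The blow-up T[I_ω]^*, with (ℕ, ≺) ≅ ℚ realised as ℚ itself.

blowup : ∀ {k} → Exp k → Exp k
blowup {k} S = record
  { V = Exp.V S × ℚ
  ; E = λ { (x , i) (y , j) → Exp.E S x y }
  ; L = λ { (x , i) (y , j) → Exp.L S x y ⊎ (x ≡ y × i ℚ.< j) }
  ; P = λ { c (x , i) → Exp.P S c x }
  }

Qstar : Exp 0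
Qstar = record { V = ℚ ; E = ℚ._<_ ; L = ℚ._<_ ; P = λ () }

-- A point of D in the right half (angle in (-π/2, π/2)) or left
-- half (angle in (π/2, 3π/2)) is recorded by t = tan(angle).  We take
-- D = ℚ, the right half = rationals with odd (reduced) denominator and the
-- left half = rationals with even denominator (two disjoint dense sets, so
-- no antipodal points).

OddDen : ℚ → Set
OddDen q = ℚ.denominatorℕ q % 2 ≡ 1

EvenDen : ℚ → Set
EvenDen q = ℚ.denominatorℕ q % 2 ≡ 0

Half : Fin 2 → ℚ → Set
Half zero q = OddDen q
Half (suc zero) q = EvenDen q

SameHalf : ℚ → ℚ → Set
SameHalf x y = (OddDen x × OddDen y) ⊎ (EvenDen x × EvenDen y)

DiffHalf : ℚ → ℚ → Set
DiffHalf x y = (OddDen x × EvenDen y) ⊎ (EvenDen x × OddDen y)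

S2E : ℚ → ℚ → Set
S2E x y = (SameHalf x y × x ℚ.< y) ⊎ (DiffHalf x y × y ℚ.< x)

S2L : ℚ → ℚ → Set
S2L x y = (SameHalf x y × S2E x y) ⊎ (DiffHalf x y × S2E y x)

S2star : Exp 2
S2star = record { V = ℚ ; E = S2E ; L = S2L ; P = Half }

-- T^{ω*}: the Fraïssé limit of all finite linearly ordered tournaments,
-- characterised as a countable homogeneous structure with that age.

Countable : Set → Set
Countable X = Σ (X → ℕ) (Injective _≡_ _≡_)

Homogeneous : ∀ {k} → Exp k → Set₁
Homogeneous {k} S =
  ∀ (n : ℕ) (A : FRel n) (a : Expn k n) (f g : Fin n → Exp.V S) →
  IsEmb (expand A a) S f → IsEmb (expand A a) S g →
  Σ (Exp.V S → Exp.V S) λ σ → IsEmb S S σ × Surjective _≡_ _≡_ σ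
    × (∀ x → σ (f x) ≡ g x)

IsTournament : ∀ {n} → FRel n → Set
IsTournament {n} R =
  (∀ x → ¬ R x x) × (∀ x y → ¬ (R x y × R y x)) × (∀ x y → ¬ x ≡ y → R x y ⊎ R y x)

IsStrictLinearOrder : ∀ {n} → FRel n → Set
IsStrictLinearOrder {n} R =
  (∀ x → ¬ R x x) × (∀ x y z → R x y → R y z → R x z) × (∀ x y → ¬ x ≡ y → R x y ⊎ R y x)

IsTωStar : Exp 0 → Set₁
IsTωStar S = Countable (Exp.V S) × Homogeneous S ×
  (∀ (n : ℕ) (A : FRel n) (a : Expn 0 n) →
     InAge S A a ⇔ (IsTournament A × IsStrictLinearOrder (Expn.L a)))

Thm55For : ∀ {k} → Exp k → Set₁
Thm55For S = ExpansionProperty S → ExpansionProperty (blowup S)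

module Submission where

-- The argument uses only that T^* is an ordered tournament: E is irreflexive
-- and relates any two distinct points, < is irreflexive, and equality is
-- decidable.  A point (x , q) of the blow-up has base x and height q; the
-- points with a common base form a fibre.  In a tournament two points are
-- equal iff they are not E-related, so the fibres of a finite A ⊆ T[I_ω] do
-- not depend on how A is embedded.  Given A with n points, take a transversal
-- of its fibres, giving A₀ ∈ Age(T); the expansion property of T^* yields B₀,
-- and B replaces every vertex of B₀ by a block of n+1 points.  For expansions
-- a of A and b of B, the restrictions a₀ (to the transversal) and b₀ (to the
-- first point of every block) lie in Age(T^*), so a₀ embeds into b₀ by some
-- φ₀; sending each fibre of A order-preservingly (by heights) into the block
-- chosen by φ₀ extends φ₀ to an embedding of a into b.

open import Defs

open import Level using (0ℓ)
open import Data.Nat as ℕ using (ℕ; zero; suc; _≤_; _*_; _%_; s≤s)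
import Data.Nat.Properties as ℕP
open import Data.Nat.DivMod using (m%n<n)
open import Data.Nat.Coprimality using (1-coprimeTo) renaming (sym to coprime-sym)
open import Data.Integer as ℤ using (+_)
open import Data.Rational as ℚ using (ℚ; mkℚ)
import Data.Rational.Properties as ℚP
open import Data.Fin as Fin using (Fin; zero; suc; toℕ; fromℕ<; punchOut; combine; remQuot)
import Data.Fin.Properties as FinP
open import Data.Fin.Subset using (Subset; inside; outside; _∈_; _∉_; ⊤; ∣_∣)
open import Data.Fin.Subset.Properties using (p⊂q⇒∣p∣<∣q∣; ∈⊤; ∣⊤∣≡n)
open import Data.Vec using (tabulate)
open import Data.Vec.Properties using (lookup⇒[]=; []=⇒lookup; lookup∘tabulate)
open import Data.Bool using (if_then_else_)
open import Data.Product using (∃; _×_; _,_; proj₁; proj₂)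
open import Data.Product.Relation.Binary.Lex.Strict using (×-strictTotalOrder)
open import Data.Sum using (_⊎_; inj₁; inj₂; [_,_])
open import Relation.Nullary using (¬_; yes; no; does; contradiction)
open import Relation.Nullary.Decidable using (map′)
open import Relation.Unary using (Pred; Decidable)
open import Relation.Binary using (StrictTotalOrder; DecidableEquality; tri<; tri≈; tri>)
open import Relation.Binary.Bundles using (Setoid)
open import Relation.Binary.PropositionalEquality
  using (_≡_; _≢_; refl; sym; trans; cong; cong₂; subst; module ≡-Reasoning)
import Relation.Binary.Reasoning.Setoid as SetoidReasoning
open import Function.Bundles using (_⇔_; mk⇔; Equivalence)
open import Function.Definitions using (Injective)
open import Function.Properties.Equivalence using (⇔-setoid)

open Equivalence using (to; from)
open Setoid (⇔-setoid 0ℓ) using ()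
  renaming (refl to ⇔-refl; reflexive to ≡⇒⇔; sym to ⇔-sym; trans to ⇔-trans)

module ⇔-Reasoning = SetoidReasoning (⇔-setoid 0ℓ)

select : ∀ {n} {P : Pred (Fin n) 0ℓ} → Decidable P → Subset n
select P? = tabulate (λ i → if does (P? i) then inside else outside)

select-∈ : ∀ {n} {P : Pred (Fin n) 0ℓ} (P? : Decidable P) (i : Fin n) → i ∈ select P? ⇔ P i
select-∈ P? i with P? i | lookup∘tabulate (λ j → if does (P? j) then inside else outside) i
... | yes p | eq = mk⇔ (λ _ → p) (λ _ → lookup⇒[]= i _ eq)
... | no ¬p | eq = mk⇔ (λ i∈ → contradiction (trans (sym eq) ([]=⇒lookup i∈)) λ ())
                       (λ p → contradiction p ¬p)

injective⇒surjective : ∀ {N} (f : Fin N → Fin N) → Injective _≡_ _≡_ f →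
  ∀ t → ∃ λ j → f j ≡ t
injective⇒surjective {zero} f f-injective ()
injective⇒surjective {suc N} f f-injective t with FinP.any? (λ j → f j FinP.≟ t)
... | yes hit = hit
... | no miss = contradiction collision noCollision
  where
  -- if t is missed, f squeezes Fin (suc N) into Fin N
  avoids : ∀ j → t ≢ f j
  avoids j t≡fj = miss (j , sym t≡fj)
  squeeze : Fin (suc N) → Fin N
  squeeze j = punchOut (avoids j)
  collision : ∃ λ i → ∃ λ j → i Fin.< j × squeeze i ≡ squeeze j
  collision = FinP.pigeonhole (ℕP.n<1+n N) squeeze
  noCollision : ¬ (∃ λ i → ∃ λ j → i Fin.< j × squeeze i ≡ squeeze j)
  noCollision (i , j , i<j , eq) =
    FinP.<-irrefl (f-injective (FinP.punchOut-injective (avoids i) (avoids j) eq)) i<j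

module Rank (O : StrictTotalOrder 0ℓ 0ℓ 0ℓ) where
  open StrictTotalOrder O renaming (Carrier to C; trans to <-trans)

  module _ {n} (v : Fin n → C) where

    below : Fin n → Subset n
    below i = select (λ j → v j <? v i)

    rank : Fin n → ℕ
    rank i = ∣ below i ∣

    below-∈ : ∀ {i} l → l ∈ below i ⇔ v l < v i
    below-∈ {i} = select-∈ (λ j → v j <? v i)

    i∉below-i : ∀ i → i ∉ below i
    i∉below-i i i∈ = irrefl Eq.refl (to (below-∈ i) i∈)

    -- below i ⊂ below j, with i as the witness of strictness
    rank-mono : ∀ {i j} → v i < v j → rank i ℕ.< rank j
    rank-mono {i} {j} vi<vj = p⊂q⇒∣p∣<∣q∣
      ( (λ {l} l∈ → from (below-∈ l) (<-trans (to (below-∈ l) l∈) vi<vj))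
      , i , from (below-∈ i) vi<vj , i∉below-i i)

    -- below i ⊂ ⊤, with i as the witness of strictness
    rank<n : ∀ i → rank i ℕ.< n
    rank<n i = subst (rank i ℕ.<_) (∣⊤∣≡n n)
      (p⊂q⇒∣p∣<∣q∣ ((λ _ → ∈⊤) , i , ∈⊤ , i∉below-i i))

    module _ (v-injective : Injective _≡_ _≈_ v) where

      rank-injective : ∀ {i j} → rank i ≡ rank j → i ≡ j
      rank-injective {i} {j} eq with compare (v i) (v j)
      ... | tri< lt _ _    = contradiction eq (ℕP.<⇒≢ (rank-mono lt))
      ... | tri≈ _ vi≈vj _ = v-injective vi≈vj
      ... | tri> _ _ gt    = contradiction (sym eq) (ℕP.<⇒≢ (rank-mono gt))

      rank-reflects : ∀ {i j} → rank i ℕ.< rank j → v i < v j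
      rank-reflects {i} {j} r with compare (v i) (v j)
      ... | tri< lt _ _    = lt
      ... | tri≈ _ vi≈vj _ = contradiction (cong rank (v-injective vi≈vj)) (ℕP.<⇒≢ r)
      ... | tri> _ _ gt    = contradiction r (ℕP.<-asym (rank-mono gt))

      rank-<⇔ : ∀ {i j} → v i < v j ⇔ rank i ℕ.< rank j
      rank-<⇔ = mk⇔ rank-mono rank-reflects

module _ (O₁ O₂ : StrictTotalOrder 0ℓ 0ℓ 0ℓ) where
  open StrictTotalOrder O₁ using () renaming (Carrier to C₁; _≈_ to _≈₁_; _<_ to _<₁_)
  open StrictTotalOrder O₂ using () renaming (Carrier to C₂; _≈_ to _≈₂_; _<_ to _<₂_)

  record OrderEmbedding {n N} (v : Fin n → C₁) (w : Fin N → C₂) : Set where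
    field
      κ : Fin n → Fin N
      κ-injective : Injective _≡_ _≡_ κ
      κ-<⇔ : ∀ {i j} → v i <₁ v j ⇔ w (κ i) <₂ w (κ j)

  -- n distinct elements of one strict total order embed into any N ≥ n
  -- distinct elements of another: send the element of rank r to the element
  -- of rank r, which exists as the ranks of the targets permute Fin N.
  orderEmbedding : ∀ {n N} → n ≤ N → (v : Fin n → C₁) → Injective _≡_ _≈₁_ v →
    (w : Fin N → C₂) → Injective _≡_ _≈₂_ w → OrderEmbedding v w
  orderEmbedding {n} {N} n≤N v v-injective w w-injective =
    record { κ = κ ; κ-injective = κ-injective ; κ-<⇔ = κ-<⇔ }
    where
    module R₁ = Rank O₁
    module R₂ = Rank O₂

    rankᵛ : Fin n → Fin N
    rankᵛ i = fromℕ< (ℕP.<-≤-trans (R₁.rank<n v i) n≤N)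

    rankʷ : Fin N → Fin N
    rankʷ j = fromℕ< (R₂.rank<n w j)

    rankʷ-injective : Injective _≡_ _≡_ rankʷ
    rankʷ-injective eq = R₂.rank-injective w w-injective
      (trans (sym (FinP.toℕ-fromℕ< _)) (trans (cong toℕ eq) (FinP.toℕ-fromℕ< _)))

    unrank : ∀ t → ∃ λ j → rankʷ j ≡ t
    unrank = injective⇒surjective rankʷ rankʷ-injective

    κ : Fin n → Fin N
    κ i = proj₁ (unrank (rankᵛ i))

    κ-rank : ∀ i → R₂.rank w (κ i) ≡ R₁.rank v i
    κ-rank i = begin
      R₂.rank w (κ i)   ≡⟨ FinP.toℕ-fromℕ< _ ⟨
      toℕ (rankʷ (κ i)) ≡⟨ cong toℕ (proj₂ (unrank (rankᵛ i))) ⟩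
      toℕ (rankᵛ i)     ≡⟨ FinP.toℕ-fromℕ< _ ⟩
      R₁.rank v i       ∎
      where open ≡-Reasoning

    κ-injective : Injective _≡_ _≡_ κ
    κ-injective {i} {j} eq = R₁.rank-injective v v-injective
      (trans (sym (κ-rank i)) (trans (cong (R₂.rank w) eq) (κ-rank j)))

    κ-<⇔ : ∀ {i j} → v i <₁ v j ⇔ w (κ i) <₂ w (κ j)
    κ-<⇔ {i} {j} = begin
      v i <₁ v j                          ≈⟨ R₁.rank-<⇔ v v-injective ⟩
      R₁.rank v i ℕ.< R₁.rank v j         ≡⟨ cong₂ ℕ._<_ (κ-rank i) (κ-rank j) ⟨
      R₂.rank w (κ i) ℕ.< R₂.rank w (κ j) ≈⟨ R₂.rank-<⇔ w w-injective ⟨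
      w (κ i) <₂ w (κ j)                  ∎
      where open ⇔-Reasoning

record Transversal {V : Set} {n} (d : Fin n → V) : Set where
  field
    size : ℕ
    rep : Fin size → Fin n
    cls : Fin n → Fin size
    rep-injective : ∀ {u v} → d (rep u) ≡ d (rep v) → u ≡ v
    rep-cls : ∀ x → d (rep (cls x)) ≡ d x

  cls-≡⇔ : ∀ {x y} → cls x ≡ cls y ⇔ d x ≡ d y
  cls-≡⇔ {x} {y} = mk⇔
    (λ eq → trans (sym (rep-cls x)) (trans (cong (λ u → d (rep u)) eq) (rep-cls y)))
    (λ eq → rep-injective (trans (rep-cls x) (trans eq (sym (rep-cls y)))))

transversal : ∀ {V : Set} → DecidableEquality V → ∀ {n} (d : Fin n → V) → Transversal d
transversal _≟_ {zero} d =
  record { size = 0 ; rep = λ () ; cls = λ () ; rep-injective = λ { {()} } ; rep-cls = λ () }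
transversal _≟_ {suc n} d with transversal _≟_ (λ i → d (suc i))
... | Tr with FinP.any? (λ u → d zero ≟ d (suc (Transversal.rep Tr u)))
...   | yes (u , d0≡) = record
  { size = size ; rep = λ w → suc (rep w) ; cls = cls′
  ; rep-injective = rep-injective ; rep-cls = rep-cls′ }
  where
  open Transversal Tr
  cls′ : Fin (suc n) → Fin size
  cls′ zero = u
  cls′ (suc x) = cls x
  rep-cls′ : ∀ x → d (suc (rep (cls′ x))) ≡ d x
  rep-cls′ zero = sym d0≡
  rep-cls′ (suc x) = rep-cls x
...   | no new = record
  { size = suc size ; rep = rep′ ; cls = cls′
  ; rep-injective = rep′-injective ; rep-cls = rep-cls′ }
  where
  open Transversal Tr
  rep′ : Fin (suc size) → Fin (suc n)
  rep′ zero = zero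
  rep′ (suc w) = suc (rep w)
  cls′ : Fin (suc n) → Fin (suc size)
  cls′ zero = zero
  cls′ (suc x) = suc (cls x)
  rep′-injective : ∀ {u v} → d (rep′ u) ≡ d (rep′ v) → u ≡ v
  rep′-injective {zero} {zero} _ = refl
  rep′-injective {zero} {suc v} eq = contradiction (v , eq) new
  rep′-injective {suc u} {zero} eq = contradiction (u , sym eq) new
  rep′-injective {suc u} {suc v} eq = cong suc (rep-injective eq)
  rep-cls′ : ∀ x → d (rep′ (cls′ x)) ≡ d x
  rep-cls′ zero = refl
  rep-cls′ (suc x) = rep-cls x

module Blocks {m₀ : ℕ} (N : ℕ) where

  ⟨_,_⟩ : Fin m₀ → Fin N → Fin (m₀ * N)
  ⟨ u , j ⟩ = combine u j

  block : Fin (m₀ * N) → Fin m₀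
  block w = proj₁ (remQuot {m₀} N w)

  slot : Fin (m₀ * N) → Fin N
  slot w = proj₂ (remQuot {m₀} N w)

  block-⟨⟩ : ∀ u j → block ⟨ u , j ⟩ ≡ u
  block-⟨⟩ u j = cong proj₁ (FinP.remQuot-combine {k = N} u j)

  ⟨block,slot⟩ : ∀ w → ⟨ block w , slot w ⟩ ≡ w
  ⟨block,slot⟩ = FinP.combine-remQuot {m₀} N

  blockBlowup : FRel m₀ → FRel (m₀ * N)
  blockBlowup B₀ w w′ = B₀ (block w) (block w′)

  slotHeight : Fin N → ℚ
  slotHeight j = mkℚ (+ toℕ j) 0 (coprime-sym (1-coprimeTo (toℕ j)))

  slotHeight-injective : Injective _≡_ _≡_ slotHeight
  slotHeight-injective eq = FinP.toℕ-injective (cong (λ q → ℤ.∣ ℚ.numerator q ∣) eq)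

record IsOrderedTournament {k} (S : Exp k) : Set where
  open Exp S
  field
    _≟_ : DecidableEquality V
    E-irrefl : ∀ x → ¬ E x x
    E-total : ∀ x y → x ≢ y → E x y ⊎ E y x
    L-irrefl : ∀ x → ¬ L x x

restrictExpn : ∀ {k n n₀} → Expn k n → (Fin n₀ → Fin n) → Expn k n₀
restrictExpn a r = record { L = λ u v → Expn.L a (r u) (r v) ; P = λ c u → Expn.P a c (r u) }

module Blowup {k} (S : Exp k) where
  open Exp S

  -- The order of the blow-up between points whose heights are irrelevant
  -- (distinct fibres, or equal points) is the order of their base points.
  L⁺⇔L : ∀ {p q : V × ℚ} → (proj₁ p ≡ proj₁ q → proj₂ p ≡ proj₂ q) →
    Exp.L (blowup S) p q ⇔ L (proj₁ p) (proj₁ q)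
  L⁺⇔L sep = mk⇔ [ (λ l → l) , (λ (eq , lt) → contradiction lt (ℚP.<-irrefl (sep eq))) ] inj₁

  L⁺⇔< : (∀ x → ¬ L x x) → ∀ {p q : V × ℚ} → proj₁ p ≡ proj₁ q →
    Exp.L (blowup S) p q ⇔ proj₂ p ℚ.< proj₂ q
  L⁺⇔< L-irrefl {p} eq = mk⇔
    [ (λ l → contradiction (subst (L (proj₁ p)) (sym eq) l) (L-irrefl (proj₁ p))) , proj₂ ]
    (λ lt → inj₂ (eq , lt))

  blockBlowup-inAge : ∀ {m₀} N {B₀ : FRel m₀} → InAgeG (reduct S) B₀ →
    InAgeG (reduct (blowup S)) (Blocks.blockBlowup N B₀)
  blockBlowup-inAge {m₀} N (h , h-injective , h-E) =
    embedding , injective , (λ w w′ → h-E (block w) (block w′))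
    where
    open Blocks {m₀} N
    embedding : Fin (m₀ * N) → V × ℚ
    embedding w = h (block w) , slotHeight (slot w)
    injective : Injective _≡_ _≡_ embedding
    injective {w} {w′} eq = begin
      w                      ≡⟨ ⟨block,slot⟩ w ⟨
      ⟨ block w , slot w ⟩   ≡⟨ cong₂ ⟨_,_⟩ (h-injective (cong proj₁ eq))
                                             (slotHeight-injective (cong proj₂ eq)) ⟩
      ⟨ block w′ , slot w′ ⟩ ≡⟨ ⟨block,slot⟩ w′ ⟩
      w′                     ∎
      where open ≡-Reasoning

  module Embedding {n} {A : FRel n} {a : Expn k n} {f : Fin n → V × ℚ}
    (f-emb : IsEmb (expand A a) (blowup S) f) where

    base : Fin n → V
    base x = proj₁ (f x)

    height : Fin n → ℚ
    height x = proj₂ (f x)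

    f-injective : Injective _≡_ _≡_ f
    f-injective = proj₁ f-emb

    f-E : ∀ x y → A x y ⇔ E (base x) (base y)
    f-E = proj₁ (proj₂ f-emb)

    f-L : ∀ x y → Expn.L a x y ⇔ Exp.L (blowup S) (f x) (f y)
    f-L = proj₁ (proj₂ (proj₂ f-emb))

    f-P : ∀ c x → Expn.P a c x ⇔ P c (base x)
    f-P = proj₂ (proj₂ (proj₂ f-emb))

    P-fibre : ∀ c {x y} → base x ≡ base y → Expn.P a c x ⇔ Expn.P a c y
    P-fibre c {x} {y} eq = begin
      Expn.P a c x    ≈⟨ f-P c x ⟩
      P c (base x)    ≡⟨ cong (P c) eq ⟩
      P c (base y)    ≈⟨ f-P c y ⟨
      Expn.P a c y    ∎
      where open ⇔-Reasoning

    L-fibres : ∀ {x y} → base x ≢ base y → Expn.L a x y ⇔ L (base x) (base y)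
    L-fibres {x} {y} ne = ⇔-trans (f-L x y) (L⁺⇔L (λ eq → contradiction eq ne))

    L-transfer : ∀ {x y x′ y′} → base x ≡ base x′ → base y ≡ base y′ →
      base x ≢ base y → Expn.L a x y ⇔ Expn.L a x′ y′
    L-transfer {x} {y} {x′} {y′} eqx eqy ne = begin
      Expn.L a x y           ≈⟨ L-fibres ne ⟩
      L (base x) (base y)    ≡⟨ cong₂ L eqx eqy ⟩
      L (base x′) (base y′)  ≈⟨ L-fibres (λ eq → ne (trans eqx (trans eq (sym eqy)))) ⟨
      Expn.L a x′ y′         ∎
      where open ⇔-Reasoning

    L-fibre : (∀ x → ¬ L x x) → ∀ {x y} → base x ≡ base y →
      Expn.L a x y ⇔ height x ℚ.< height y
    L-fibre L-irrefl {x} {y} eq = ⇔-trans (f-L x y) (L⁺⇔< L-irrefl eq)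

    restrict : ∀ {n₀} (A₀ : FRel n₀) (r : Fin n₀ → Fin n) →
      (∀ u v → A₀ u v ⇔ A (r u) (r v)) →
      (∀ {u v} → base (r u) ≡ base (r v) → u ≡ v) → InAge S A₀ (restrictExpn a r)
    restrict A₀ r A₀⇔A r-separates = (λ u → base (r u)) , r-separates
      , (λ u v → ⇔-trans (A₀⇔A u v) (f-E (r u) (r v)))
      , (λ u v → ⇔-trans (f-L (r u) (r v))
                         (L⁺⇔L (λ eq → cong (λ w → height (r w)) (r-separates eq))))
      , (λ c u → f-P c (r u))

module _ {k} {S : Exp k} (T : IsOrderedTournament S) where
  open Exp S
  open IsOrderedTournament T
  open Blowup S

  -- In a tournament two vertices coincide iff neither is E-related to the
  -- other, so two maps inducing the same E-relation have the same kernel.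
  same-kernel : ∀ {I : Set} {p q : I → V} → (∀ x y → E (p x) (p y) ⇔ E (q x) (q y)) →
    ∀ {x y} → p x ≡ p y → q x ≡ q y
  same-kernel {p = p} {q} p⇔q {x} {y} eq with q x ≟ q y
  ... | yes eq′ = eq′
  ... | no ne with E-total _ _ ne
  ...   | inj₁ e = contradiction (subst (E (p x)) (sym eq) (from (p⇔q x y) e)) (E-irrefl _)
  ...   | inj₂ e = contradiction (subst (E (p y)) eq (from (p⇔q y x) e)) (E-irrefl _)

  module FibreStructure {n} {A : FRel n} {d : Fin n → V} (d-E : ∀ x y → A x y ⇔ E (d x) (d y))
    (Tr : Transversal d) where
    open Transversal Tr

    A₀ : FRel size
    A₀ u v = A (rep u) (rep v)

    A₀-inAge : InAgeG (reduct S) A₀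
    A₀-inAge = (λ u → d (rep u)) , rep-injective , (λ u v → d-E (rep u) (rep v))

    A⇔A₀ : ∀ x y → A x y ⇔ A₀ (cls x) (cls y)
    A⇔A₀ x y = begin
      A x y                                 ≈⟨ d-E x y ⟩
      E (d x) (d y)                         ≡⟨ cong₂ E (rep-cls x) (rep-cls y) ⟨
      E (d (rep (cls x))) (d (rep (cls y))) ≈⟨ d-E (rep (cls x)) (rep (cls y)) ⟨
      A₀ (cls x) (cls y)                    ∎
      where open ⇔-Reasoning

  module Extension {n} {A : FRel n} {d : Fin n → V} (d-E : ∀ x y → A x y ⇔ E (d x) (d y))
    (Tr : Transversal d) {m₀} {B₀ : FRel m₀} {h : Fin m₀ → V}
    (h-emb : IsEmbG (asGraph B₀) (reduct S) h) where
    open Transversal Tr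
    open FibreStructure d-E Tr
    open Blocks {m₀} (suc n)

    B : FRel (m₀ * suc n)
    B = blockBlowup B₀

    B-inAge : InAgeG (reduct (blowup S)) B
    B-inAge = blockBlowup-inAge (suc n) (h , h-emb)

    first : Fin m₀ → Fin (m₀ * suc n)
    first u = ⟨ u , zero ⟩

    block-first : ∀ u → block (first u) ≡ u
    block-first u = block-⟨⟩ u zero

    module _ {a : Expn k n} {b : Expn k (m₀ * suc n)} {f g}
      (f-emb : IsEmb (expand A a) (blowup S) f) (g-emb : IsEmb (expand B b) (blowup S) g) where
      module F = Embedding f-emb
      module G = Embedding g-emb

      -- Embeddings of the same digraph into the blow-up of a tournament
      -- induce the same fibres: for A the fibres of d, for B the blocks.
      d≡⇔F≡ : ∀ {x y} → d x ≡ d y ⇔ F.base x ≡ F.base y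
      d≡⇔F≡ = mk⇔
        (same-kernel (λ x y → ⇔-trans (⇔-sym (d-E x y)) (F.f-E x y)))
        (same-kernel (λ x y → ⇔-trans (⇔-sym (F.f-E x y)) (d-E x y)))

      cls≡⇔F≡ : ∀ {x y} → cls x ≡ cls y ⇔ F.base x ≡ F.base y
      cls≡⇔F≡ = ⇔-trans cls-≡⇔ d≡⇔F≡

      block≡⇔G≡ : ∀ {w w′} → block w ≡ block w′ ⇔ G.base w ≡ G.base w′
      block≡⇔G≡ = mk⇔
        (λ eq → same-kernel (λ w w′ → ⇔-trans (⇔-sym (hE w w′)) (G.f-E w w′)) (cong h eq))
        (λ eq → proj₁ h-emb
          (same-kernel (λ w w′ → ⇔-trans (⇔-sym (G.f-E w w′)) (hE w w′)) eq))
        where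
        hE : ∀ w w′ → B w w′ ⇔ E (h (block w)) (h (block w′))
        hE w w′ = proj₂ h-emb (block w) (block w′)

      a₀ : Expn k size
      a₀ = restrictExpn a rep

      b₀ : Expn k m₀
      b₀ = restrictExpn b first

      a₀-inAge : InAge S A₀ a₀
      a₀-inAge = F.restrict A₀ rep (λ _ _ → ⇔-refl)
        (λ eq → rep-injective (from d≡⇔F≡ eq))

      b₀-inAge : InAge S B₀ b₀
      b₀-inAge = G.restrict B₀ first
        (λ u v → ≡⇒⇔ (cong₂ B₀ (sym (block-first u)) (sym (block-first v))))
        (λ {u} {v} eq → trans (sym (block-first u)) (trans (from block≡⇔G≡ eq) (block-first v)))

      blockHeight-injective : ∀ u → Injective _≡_ _≡_ (λ j → G.height ⟨ u , j ⟩)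
      blockHeight-injective u {i} {j} eq =
        FinP.combine-injectiveʳ u i u j (G.f-injective (cong₂ _,_ sameBase eq))
        where
        sameBase : G.base ⟨ u , i ⟩ ≡ G.base ⟨ u , j ⟩
        sameBase = to block≡⇔G≡ (trans (block-⟨⟩ u i) (sym (block-⟨⟩ u j)))

      -- Heights of the points of A with ties broken by the index: an
      -- injective family, ordered lexicographically.
      HeightIndex : StrictTotalOrder 0ℓ 0ℓ 0ℓ
      HeightIndex = ×-strictTotalOrder ℚP.<-strictTotalOrder (FinP.<-strictTotalOrder n)

      _<ʰ_ : ℚ × Fin n → ℚ × Fin n → Set
      _<ʰ_ = StrictTotalOrder._<_ HeightIndex

      heightIndex : Fin n → ℚ × Fin n
      heightIndex x = F.height x , x

      -- Within one fibre of A ties never occur, as f is injective.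
      heightIndex-<⇔ : ∀ {x y} → F.base x ≡ F.base y →
        heightIndex x <ʰ heightIndex y ⇔ F.height x ℚ.< F.height y
      heightIndex-<⇔ {x} {y} eq = mk⇔
        [ (λ lt → lt)
        , (λ (h≡ , x<y) → contradiction (F.f-injective (cong₂ _,_ eq h≡)) (FinP.<⇒≢ x<y)) ]
        inj₁

      match : ∀ u → OrderEmbedding HeightIndex ℚP.<-strictTotalOrder
                                    heightIndex (λ j → G.height ⟨ u , j ⟩)
      match u = orderEmbedding HeightIndex ℚP.<-strictTotalOrder (ℕP.n≤1+n n)
        heightIndex proj₂ (λ j → G.height ⟨ u , j ⟩) (blockHeight-injective u)

      module Extend {φ₀ : Fin size → Fin m₀}
        (φ₀-emb : IsEmb (expand A₀ a₀) (expand B₀ b₀) φ₀) where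
        open OrderEmbedding using (κ; κ-injective; κ-<⇔)

        φ₀-injective : Injective _≡_ _≡_ φ₀
        φ₀-injective = proj₁ φ₀-emb

        φ₀-E : ∀ u v → A₀ u v ⇔ B₀ (φ₀ u) (φ₀ v)
        φ₀-E = proj₁ (proj₂ φ₀-emb)

        φ₀-L : ∀ u v → Expn.L a₀ u v ⇔ Expn.L b₀ (φ₀ u) (φ₀ v)
        φ₀-L = proj₁ (proj₂ (proj₂ φ₀-emb))

        φ₀-P : ∀ c u → Expn.P a₀ c u ⇔ Expn.P b₀ c (φ₀ u)
        φ₀-P = proj₂ (proj₂ (proj₂ φ₀-emb))

        φ : Fin n → Fin (m₀ * suc n)
        φ x = ⟨ φ₀ (cls x) , κ (match (φ₀ (cls x))) x ⟩

        block-φ : ∀ x → block (φ x) ≡ φ₀ (cls x)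
        block-φ x = block-⟨⟩ _ _

        F-fibre-rep : ∀ x → F.base (rep (cls x)) ≡ F.base x
        F-fibre-rep x = to d≡⇔F≡ (rep-cls x)

        G-fibre-φ : ∀ x → G.base (first (φ₀ (cls x))) ≡ G.base (φ x)
        G-fibre-φ x = to block≡⇔G≡ (trans (block-first _) (sym (block-φ x)))

        φ-injective : Injective _≡_ _≡_ φ
        φ-injective {x} {y} eq = κ-across
          (FinP.combine-injectiveˡ (φ₀ (cls x)) _ (φ₀ (cls y)) _ eq)
          (FinP.combine-injectiveʳ (φ₀ (cls x)) _ (φ₀ (cls y)) _ eq)
          where
          κ-across : ∀ {u u′} → u ≡ u′ → κ (match u) x ≡ κ (match u′) y → x ≡ y
          κ-across {u} refl = κ-injective (match u)

        φ-E : ∀ x y → A x y ⇔ B (φ x) (φ y)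
        φ-E x y = begin
          A x y                         ≈⟨ A⇔A₀ x y ⟩
          A₀ (cls x) (cls y)            ≈⟨ φ₀-E (cls x) (cls y) ⟩
          B₀ (φ₀ (cls x)) (φ₀ (cls y))  ≡⟨ cong₂ B₀ (block-φ x) (block-φ y) ⟨
          B (φ x) (φ y)                 ∎
          where open ⇔-Reasoning

        φ-P : ∀ c x → Expn.P a c x ⇔ Expn.P b c (φ x)
        φ-P c x = begin
          Expn.P a c x                     ≈⟨ F.P-fibre c (F-fibre-rep x) ⟨
          Expn.P a c (rep (cls x))         ≈⟨ φ₀-P c (cls x) ⟩
          Expn.P b c (first (φ₀ (cls x)))  ≈⟨ G.P-fibre c (G-fibre-φ x) ⟩
          Expn.P b c (φ x)                 ∎
          where open ⇔-Reasoning

        -- Points of one fibre: compare heights, which κ carries into the block.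
        φ-L-fibre : ∀ {x y} → cls x ≡ cls y → Expn.L a x y ⇔ Expn.L b (φ x) (φ y)
        φ-L-fibre {x} {y} eq = begin
          Expn.L a x y                         ≈⟨ F.L-fibre L-irrefl F≡ ⟩
          F.height x ℚ.< F.height y            ≈⟨ heightIndex-<⇔ F≡ ⟨
          heightIndex x <ʰ heightIndex y       ≈⟨ κ-<⇔ (match u) ⟩
          G.height (φᵤ x) ℚ.< G.height (φᵤ y)  ≡⟨ cong (λ w → _ ℚ.< G.height w) φᵤy≡φy ⟩
          G.height (φ x) ℚ.< G.height (φ y)    ≈⟨ G.L-fibre L-irrefl G≡ ⟨
          Expn.L b (φ x) (φ y)                 ∎
          where
          open ⇔-Reasoning
          u : Fin m₀
          u = φ₀ (cls x)
          φᵤ : Fin n → Fin (m₀ * suc n)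
          φᵤ z = ⟨ u , κ (match u) z ⟩
          φᵤy≡φy : φᵤ y ≡ φ y
          φᵤy≡φy = cong (λ w → ⟨ φ₀ w , κ (match (φ₀ w)) y ⟩) eq
          F≡ : F.base x ≡ F.base y
          F≡ = to cls≡⇔F≡ eq
          G≡ : G.base (φ x) ≡ G.base (φ y)
          G≡ = to block≡⇔G≡ (trans (block-φ x) (trans (cong φ₀ eq) (sym (block-φ y))))

        -- Points of distinct fibres: compare representatives, which φ₀ handles.
        φ-L-fibres : ∀ {x y} → cls x ≢ cls y → Expn.L a x y ⇔ Expn.L b (φ x) (φ y)
        φ-L-fibres {x} {y} ne = begin
          Expn.L a x y                            ≈⟨ F.L-transfer (F-fibre-rep x) (F-fibre-rep y) neF ⟨
          Expn.L a₀ (cls x) (cls y)               ≈⟨ φ₀-L (cls x) (cls y) ⟩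
          Expn.L b₀ (φ₀ (cls x)) (φ₀ (cls y))     ≈⟨ G.L-transfer (G-fibre-φ x) (G-fibre-φ y) neG ⟩
          Expn.L b (φ x) (φ y)                    ∎
          where
          open ⇔-Reasoning
          neF : F.base (rep (cls x)) ≢ F.base (rep (cls y))
          neF eq = ne (from cls≡⇔F≡ (trans (sym (F-fibre-rep x)) (trans eq (F-fibre-rep y))))
          neG : G.base (first (φ₀ (cls x))) ≢ G.base (first (φ₀ (cls y)))
          neG eq = ne (φ₀-injective
            (trans (sym (block-first _)) (trans (from block≡⇔G≡ eq) (block-first _))))

        φ-L : ∀ x y → Expn.L a x y ⇔ Expn.L b (φ x) (φ y)
        φ-L x y with cls x FinP.≟ cls y
        ... | yes eq = φ-L-fibre eq
        ... | no ne  = φ-L-fibres ne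

        φ-emb : IsEmb (expand A a) (expand B b) φ
        φ-emb = φ-injective , φ-E , φ-L , φ-P

      extend : Embeds (expand A₀ a₀) (expand B₀ b₀) → Embeds (expand A a) (expand B b)
      extend (φ₀ , φ₀-emb) = Extend.φ φ₀-emb , Extend.φ-emb φ₀-emb

  blowup-expansionProperty : ExpansionProperty S → ExpansionProperty (blowup S)
  blowup-expansionProperty EP n A (e , _ , e-E) =
    let (m₀ , B₀ , (h , h-emb) , EP₀) = EP size A₀ A₀-inAge
        open Extension e-E Tr h-emb
    in m₀ * suc n , B , B-inAge , λ a b (_ , f-emb) (_ , g-emb) →
         extend f-emb g-emb (EP₀ _ _ (a₀-inAge f-emb g-emb) (b₀-inAge f-emb g-emb))
    where
    Tr : Transversal (λ x → proj₁ (e x))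
    Tr = transversal _≟_ (λ x → proj₁ (e x))
    open Transversal Tr using (size)
    open FibreStructure e-E Tr

Qstar-ordered : IsOrderedTournament Qstar
Qstar-ordered = record
  { _≟_ = ℚP._≟_
  ; E-irrefl = λ _ → ℚP.<-irrefl refl
  ; E-total = <-total
  ; L-irrefl = λ _ → ℚP.<-irrefl refl
  }
  where
  <-total : ∀ x y → x ≢ y → x ℚ.< y ⊎ y ℚ.< x
  <-total x y x≢y with ℚP.<-cmp x y
  ... | tri< lt _ _ = inj₁ lt
  ... | tri≈ _ eq _ = contradiction eq x≢y
  ... | tri> _ _ gt = inj₂ gt

halfOf : ∀ x → EvenDen x ⊎ OddDen x
halfOf x with ℚ.denominatorℕ x % 2 | m%n<n (ℚ.denominatorℕ x) 2
... | 0           | _ = inj₁ refl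
... | 1           | _ = inj₂ refl
... | suc (suc _) | s≤s (s≤s ())

halves : ∀ x y → SameHalf x y ⊎ DiffHalf x y
halves x y with halfOf x | halfOf y
... | inj₁ ex | inj₁ ey = inj₁ (inj₂ (ex , ey))
... | inj₂ ox | inj₂ oy = inj₁ (inj₁ (ox , oy))
... | inj₂ ox | inj₁ ey = inj₂ (inj₁ (ox , ey))
... | inj₁ ex | inj₂ oy = inj₂ (inj₂ (ex , oy))

SameHalf-sym : ∀ {x y} → SameHalf x y → SameHalf y x
SameHalf-sym (inj₁ (ox , oy)) = inj₁ (oy , ox)
SameHalf-sym (inj₂ (ex , ey)) = inj₂ (ey , ex)

DiffHalf-sym : ∀ {x y} → DiffHalf x y → DiffHalf y x
DiffHalf-sym (inj₁ (ox , ey)) = inj₂ (ey , ox)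
DiffHalf-sym (inj₂ (ex , oy)) = inj₁ (oy , ex)

S2star-ordered : IsOrderedTournament S2star
S2star-ordered = record
  { _≟_ = ℚP._≟_ ; E-irrefl = S2E-irrefl ; E-total = S2E-total ; L-irrefl = S2L-irrefl }
  where
  S2E-irrefl : ∀ x → ¬ S2E x x
  S2E-irrefl x (inj₁ (_ , lt)) = ℚP.<-irrefl refl lt
  S2E-irrefl x (inj₂ (_ , lt)) = ℚP.<-irrefl refl lt

  S2L-irrefl : ∀ x → ¬ S2L x x
  S2L-irrefl x (inj₁ (_ , e)) = S2E-irrefl x e
  S2L-irrefl x (inj₂ (_ , e)) = S2E-irrefl x e

  S2E-total : ∀ x y → x ≢ y → S2E x y ⊎ S2E y x
  S2E-total x y x≢y with halves x y | ℚP.<-cmp x y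
  ... | _         | tri≈ _ eq _ = contradiction eq x≢y
  ... | inj₁ same | tri< lt _ _ = inj₁ (inj₁ (same , lt))
  ... | inj₁ same | tri> _ _ gt = inj₂ (inj₁ (SameHalf-sym {x} {y} same , gt))
  ... | inj₂ diff | tri> _ _ gt = inj₁ (inj₂ (diff , gt))
  ... | inj₂ diff | tri< lt _ _ = inj₂ (inj₂ (DiffHalf-sym {x} {y} diff , lt))

countable⇒≟ : ∀ {X : Set} → Countable X → DecidableEquality X
countable⇒≟ (ι , ι-injective) x y = map′ ι-injective (cong ι) (ι x ℕ.≟ ι y)

-- A structure S with the properties of T^{ω*} is an ordered tournament:
-- any injective family of points induces a linearly ordered tournament,
-- and singletons and pairs give irreflexivity and totality.
module _ (S : Exp 0) (S-Tω : IsTωStar S) where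
  open Exp S

  induced : ∀ {m} (p : Fin m → V) → Injective _≡_ _≡_ p →
    IsTournament (λ i j → E (p i) (p j)) × IsStrictLinearOrder (λ i j → L (p i) (p j))
  induced {m} p p-injective = to (proj₂ (proj₂ S-Tω) m _ inducedOrder)
    (p , p-injective , (λ _ _ → ⇔-refl) , (λ _ _ → ⇔-refl) , λ ())
    where
    inducedOrder : Expn 0 m
    inducedOrder = record { L = λ i j → L (p i) (p j) ; P = λ () }

  singleton : V → Fin 1 → V
  singleton x _ = x

  singleton-injective : ∀ x → Injective _≡_ _≡_ (singleton x)
  singleton-injective x {zero} {zero} _ = refl

  pair : V → V → Fin 2 → V
  pair x y zero = x
  pair x y (suc zero) = y

  pair-injective : ∀ {x y} → x ≢ y → Injective _≡_ _≡_ (pair x y)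
  pair-injective x≢y {zero} {zero} _ = refl
  pair-injective x≢y {zero} {suc zero} eq = contradiction eq x≢y
  pair-injective x≢y {suc zero} {zero} eq = contradiction (sym eq) x≢y
  pair-injective x≢y {suc zero} {suc zero} _ = refl

  Tω-ordered : IsOrderedTournament S
  Tω-ordered = record
    { _≟_ = countable⇒≟ (proj₁ S-Tω)
    ; E-irrefl = λ x → proj₁ (proj₁ (induced (singleton x) (singleton-injective x))) zero
    ; E-total = λ x y x≢y →
        proj₂ (proj₂ (proj₁ (induced (pair x y) (pair-injective x≢y)))) zero (suc zero) (λ ())
    ; L-irrefl = λ x → proj₁ (proj₂ (induced (singleton x) (singleton-injective x))) zero
    }

theorem5p5 : Thm55For Qstar × Thm55For S2star × (∀ (S : Exp 0) → IsTωStar S → Thm55For S)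
theorem5p5 =
    blowup-expansionProperty Qstar-ordered
  , blowup-expansionProperty S2star-ordered
  , λ S S-Tω → blowup-expansionProperty (Tω-ordered S S-Tω)
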